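{- Let $V=\mathbb{F}_q^n$, fix a total order $\omega$ on the set of lines (1-dimensional subspaces) of $V$, and let $PD(1^n,q)$ be labelled by labelling each covering relation $\{l_1,\dots,l_r\}\prec\{l_1,\dots,l_{r+1}\}$ with the added line $l_{r+1}$, labels compared via $\omega$. This labelling is least-content-increasing.
   Context: $PD(1^n,q)$ is the poset whose elements are the sets $\{l_1,\dots,l_r\}$ of linearly independent lines in $V$ (lines spanned by linearly independent vectors; $r=0$ gives the minimum $\hat0$), ordered by inclusion, with a maximum element $\hat1$ adjoined above all bases. Covering relations into $\hat1$ carry no label. A labelling is least-increasing if in every interval the lexicographically smallest saturated chain (by label sequence) has weakly increasing labels; it is least-content-increasing if moreover the label sequence of that smallest chain is lexicographically at most the increasing rearrangement of the label sequence of every other saturated chain on the interval. -}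

module Defs where

open import Level using (0ℓ)
open import Data.Nat using (ℕ)
open import Data.Fin using (Fin)
open import Data.Vec using (Vec; []; _∷_; replicate; zipWith; map)
open import Data.List using (List; []; _∷_; length)
open import Data.List.Membership.Propositional using (_∈_; _∉_)
open import Data.List.Relation.Unary.Linked using (Linked)
open import Data.List.Relation.Binary.Permutation.Propositional using (_↭_)
open import Data.Product using (Σ; ∃; _×_; _,_)
open import Data.Sum using (_⊎_)
open import Relation.Binary using (Rel)
open import Relation.Binary.PropositionalEquality using (_≡_; _≢_)
open import Relation.Nullary using (¬_)
open import Algebra.Structures using (IsCommutativeRing)
open import Function.Bundles using (_↔_)

record FiniteField (q : ℕ) : Set₁ where
  field
    F    : Set
    _+_  : F → F → F
    _*_  : F → F → F
    -_   : F → F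
    0#   : F
    1#   : F
    isCommutativeRing : IsCommutativeRing _≡_ _+_ _*_ -_ 0# 1#
    0≢1  : 0# ≢ 1#
    inv  : ∀ x → x ≢ 0# → Σ F (λ y → (x * y) ≡ 1#)
    enum : F ↔ Fin q

module PDposet {q : ℕ} (𝔽 : FiniteField q) (n : ℕ) where
  open FiniteField 𝔽

  V : Set
  V = Vec F n

  zeroV : V
  zeroV = replicate n 0#

  _+V_ : V → V → V
  _+V_ = zipWith _+_

  _·V_ : F → V → V
  c ·V v = map (c *_) v

  -- A line (1-dimensional subspace) of V is represented by its unique
  -- spanning vector whose first nonzero coordinate equals 1.
  data Normalized : {m : ℕ} → Vec F m → Set where
    lead : ∀ {m} (v : Vec F m) → Normalized (1# ∷ v)
    skip : ∀ {m} {v : Vec F m} → Normalized v → Normalized (0# ∷ v)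

  Line : Set
  Line = Σ V Normalized

  vec : Line → V
  vec (v , _) = v

  lincomb : (ls : List Line) → Vec F (length ls) → V
  lincomb []       []       = zeroV
  lincomb (l ∷ ls) (c ∷ cs) = (c ·V vec l) +V lincomb ls cs

  Independent : List Line → Set
  Independent ls = ∀ (cs : Vec F (length ls)) →
    lincomb ls cs ≡ zeroV → cs ≡ replicate (length ls) 0#

  -- elements of PD(1^n,q): sets of linearly independent lines (a set is
  -- represented by a list; set equality/inclusion is via membership),
  -- plus an adjoined maximum 1̂.
  data PD : Set where
    set : (S : List Line) → Independent S → PD
    top : PD

  data _≤P_ : PD → PD → Set where
    set≤set : ∀ {S T iS iT} → (∀ {l} → l ∈ S → l ∈ T) → set S iS ≤P set T iT
    _≤top   : ∀ x → x ≤P top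

  _<P_ : PD → PD → Set
  x <P y = x ≤P y × ¬ (y ≤P x)

  _⋖_ : PD → PD → Set
  x ⋖ y = x <P y × ¬ (∃ λ z → x <P z × z <P y)

  -- Saturated chains from x to y, indexed by their label sequence.
  -- A cover {l_1..l_r} ⋖ {l_1..l_{r+1}} is labelled by the added line;
  -- covers into 1̂ carry no label.
  data Chain : PD → PD → List Line → Set where
    done    : ∀ {x y} → x ≤P y → y ≤P x → Chain x y []
    stepSet : ∀ {S T iS iT z ls} {l : Line} →
              set S iS ⋖ set T iT → l ∈ T → l ∉ S →
              Chain (set T iT) z ls → Chain (set S iS) z (l ∷ ls)
    stepTop : ∀ {x} → x ⋖ top → Chain x top []

module Labels {A : Set} (_≤ω_ : Rel A 0ℓ) where
  data LexLeq : List A → List A → Set where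
    nil  : ∀ {ys} → LexLeq [] ys
    less : ∀ {x y xs ys} → x ≤ω y → x ≢ y → LexLeq (x ∷ xs) (y ∷ ys)
    same : ∀ {x xs ys} → LexLeq xs ys → LexLeq (x ∷ xs) (x ∷ ys)

  Increasing : List A → Set
  Increasing = Linked _≤ω_

open PDposet public

LeastContentIncreasing : {q : ℕ} (𝔽 : FiniteField q) (n : ℕ) →
  Rel (Line 𝔽 n) 0ℓ → Set
LeastContentIncreasing 𝔽 n _≤ω_ =
  ∀ (x y : PD 𝔽 n) → _≤P_ 𝔽 n x y →
    (∃ λ ls → Chain 𝔽 n x y ls × (∀ ls′ → Chain 𝔽 n x y ls′ → LexLeq ls ls′))
    × (∀ ls → Chain 𝔽 n x y ls → (∀ ls′ → Chain 𝔽 n x y ls′ → LexLeq ls ls′) →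
         Increasing ls
         × (∀ ls′ → Chain 𝔽 n x y ls′ →
              ∀ s → s ↭ ls′ → Increasing s → LexLeq ls s))
  where open Labels _≤ω_

module Submission where

-- Starting from a set S of lines, the greedy chain repeatedly adds the ω-least line that keeps
-- the set independent and below y.  Its labels increase, because a line that is admissible after
-- a step was already admissible before it.  The labels M of any saturated chain from S to y have
-- one property that matters: S ++ M is an independent list spanning y (equal to y as a set, or a
-- basis when y = 1̂).  This property is invariant under permuting M, and wherever such an M first
-- departs from the greedy chain its line was admissible there, hence ω-above the greedy choice.
-- So the greedy labels are lexicographically below every rearrangement of every chain's labels,
-- and antisymmetry of the lexicographic order makes them the only least label sequence.

open import Defs using (FiniteField; module PDposet; module Labels; Line; LeastContentIncreasing)
open import Level using (0ℓ)
open import Data.Nat using (ℕ)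
open import Relation.Binary using (Rel; IsTotalOrder)
open import Relation.Binary.PropositionalEquality using (_≡_)

open import Data.Nat using (zero; suc; _≤_; _<_; z≤n; s≤s)
open import Data.Nat.Properties using (m≤n⇒m≤1+n; m<n⇒m<1+n)
open import Data.Nat.Induction using (<-wellFounded)
open import Induction.WellFounded using (Acc; acc)
open import Data.Fin using (Fin)
open import Data.Fin.Properties using () renaming (_≟_ to _≟Fin_)
open import Data.Vec using (Vec; []; _∷_; replicate; zipWith; map; head; tail)
open import Data.Vec.Properties using (map-cong; map-const; zipWith-identityˡ)
  renaming (≡-dec to Vec-≡-dec)
open import Data.Product.Properties using () renaming (≡-dec to Σ-≡-dec)
import Data.List as List
open import Data.List using (List; []; _∷_; _++_; [_]; length; allFin; filter; cartesianProductWith)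
open import Data.List.Relation.Unary.Any using (here; there)
open import Data.List.Relation.Unary.All as All using (All; []; _∷_)
open import Data.List.Relation.Unary.All.Properties using (¬Any⇒All¬)
open import Data.List.Relation.Unary.AllPairs using (AllPairs; []; _∷_)
open import Data.List.Relation.Unary.Linked using ([])
open import Data.List.Relation.Unary.Linked.Properties using (AllPairs⇒Linked)
open import Data.List.Relation.Unary.Unique.Propositional using (Unique)
open import Data.List.Relation.Unary.Unique.Propositional.Properties using (Unique[x∷xs]⇒x∉xs)
open import Data.List.Relation.Unary.Enumerates.Setoid.Properties using (map⁺)
open import Data.List.Membership.Propositional using (_∈_; _∉_)
open import Data.List.Membership.Propositional.Properties
  using (∈-∃++; ∈-++⁺ʳ; ∈-cartesianProductWith⁺; ∈-allFin)
open import Data.List.Relation.Binary.Subset.Propositional using (_⊆_)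
open import Data.List.Relation.Binary.Subset.Propositional.Properties
  using (⊆-trans; ⊆-reflexive-↭; ⊆-respʳ-↭; xs⊆x∷xs; ∈-∷⁺ʳ; ⊆∷∧∉⇒⊆)
  renaming (++⁺ˡ to ⊆-++⁺ˡ)
open import Data.List.Relation.Binary.Permutation.Propositional as ↭
  using (_↭_; ↭-refl; ↭-sym; ↭-trans)
open import Data.List.Relation.Binary.Permutation.Propositional.Properties
  using (shift; shifts; ++-comm; ++-assoc; ++-identityʳ)
  renaming (++⁺ʳ to ↭-++⁺ʳ; ++⁺ˡ to ↭-++⁺ˡ)
open import Data.Product using (Σ; ∃; _×_; _,_; proj₁)
open import Data.Sum using (_⊎_; inj₁; inj₂)
open import Data.Unit using (⊤; tt)
open import Relation.Nullary using (¬_; Dec; yes; no; contradiction)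
open import Relation.Nullary.Decidable
  using (_×-dec_; _→-dec_; ¬?; map′; decidable-stable; via-injection)
open import Relation.Unary using (Pred; Decidable; Irrelevant)
open import Relation.Binary using (IsTotalPreorder; Antisymmetric; DecidableEquality)
open import Relation.Binary.PropositionalEquality
  using (refl; sym; trans; cong; cong₂; subst; setoid; module ≡-Reasoning)
open import Algebra.Structures using (IsCommutativeRing)
open import Algebra.Bundles using (CommutativeSemigroup)
open import Function using (_∘_)
open import Function.Bundles using (Inverse)
open import Function.Properties.Inverse using (↔-sym; ↔⇒↣; ↔⇒↠)

module _ {A : Set} where

  unique∧⊆⇒↭++ : ∀ {T B : List A} → Unique T → T ⊆ B → ∃ λ R → B ↭ T ++ R
  unique∧⊆⇒↭++ {[]} {B} _ _ = B , ↭-refl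
  unique∧⊆⇒↭++ {t ∷ T} u@(_ ∷ uT) t∷T⊆B
    with as , bs , refl ← ∈-∃++ (t∷T⊆B (here refl))
    with R , p ← unique∧⊆⇒↭++ uT
           (⊆∷∧∉⇒⊆ (⊆-respʳ-↭ (shift t as bs) (t∷T⊆B ∘ there)) (Unique[x∷xs]⇒x∉xs u))
    = R , ↭-trans (shift t as bs) (↭.prep t p)

  ∀?-enumerated : ∀ {xs : List A} → (∀ x → x ∈ xs) →
    {P : Pred A 0ℓ} → Decidable P → Dec (∀ x → P x)
  ∀?-enumerated {xs} complete P? =
    map′ (λ all x → All.lookup all (complete x)) (λ p → All.tabulate (λ {x} _ → p x))
      (All.all? P? xs)

  vectors : List A → ∀ k → List (Vec A k)
  vectors xs zero = [ [] ]
  vectors xs (suc k) = cartesianProductWith _∷_ xs (vectors xs k)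

  ∈-vectors : ∀ {xs} → (∀ x → x ∈ xs) → ∀ {k} (v : Vec A k) → v ∈ vectors xs k
  ∈-vectors complete [] = here refl
  ∈-vectors complete (x ∷ v) = ∈-cartesianProductWith⁺ _∷_ (complete x) (∈-vectors complete v)

  module _ {P : Pred A 0ℓ} (P? : Decidable P) where

    filterΣ : List A → List (Σ A P)
    filterΣ [] = []
    filterΣ (x ∷ xs) with P? x
    ... | yes p = (x , p) ∷ filterΣ xs
    ... | no _ = filterΣ xs

    ∈-filterΣ : Irrelevant P → ∀ {x xs} (p : P x) → x ∈ xs → (x , p) ∈ filterΣ xs
    ∈-filterΣ irr {x} {x ∷ xs} p (here refl) with P? x
    ... | yes p′ = here (cong (x ,_) (irr p p′))
    ... | no ¬p = contradiction p ¬p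
    ∈-filterΣ irr {x} {y ∷ xs} p (there x∈xs) with P? y
    ... | yes _ = there (∈-filterΣ irr p x∈xs)
    ... | no _ = ∈-filterΣ irr p x∈xs

  module _ {P Q : Pred A 0ℓ} (P? : Decidable P) (Q? : Decidable Q) (P⇒Q : ∀ {x} → P x → Q x) where

    length-filter-mono : ∀ xs → length (filter P? xs) ≤ length (filter Q? xs)
    length-filter-mono [] = z≤n
    length-filter-mono (x ∷ xs) with P? x | Q? x
    ... | yes _ | yes _ = s≤s (length-filter-mono xs)
    ... | yes p | no ¬q = contradiction (P⇒Q p) ¬q
    ... | no _ | yes _ = m≤n⇒m≤1+n (length-filter-mono xs)
    ... | no _ | no _ = length-filter-mono xs

    length-filter-< : ∀ {x xs} → x ∈ xs → Q x → ¬ P x →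
      length (filter P? xs) < length (filter Q? xs)
    length-filter-< {x} {x ∷ xs} (here refl) q ¬p with P? x | Q? x
    ... | yes p | _ = contradiction p ¬p
    ... | no _ | no ¬q = contradiction q ¬q
    ... | no _ | yes _ = s≤s (length-filter-mono xs)
    length-filter-< {x} {y ∷ xs} (there x∈xs) q ¬p with P? y | Q? y
    ... | yes _ | yes _ = s≤s (length-filter-< x∈xs q ¬p)
    ... | yes p | no ¬q = contradiction (P⇒Q p) ¬q
    ... | no _ | yes _ = m<n⇒m<1+n (length-filter-< x∈xs q ¬p)
    ... | no _ | no _ = length-filter-< x∈xs q ¬p

  module _ {_≤ₐ_ : Rel A 0ℓ} (isTotalPreorder : IsTotalPreorder _≡_ _≤ₐ_)
           {P : Pred A 0ℓ} (P? : Decidable P) where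
    open IsTotalPreorder isTotalPreorder using (total) renaming (refl to ≤-refl; trans to ≤-trans)

    least? : ∀ xs → (∀ {x} → x ∈ xs → ¬ P x) ⊎ ∃ λ m → P m × (∀ {x} → x ∈ xs → P x → m ≤ₐ x)
    least? [] = inj₁ (λ ())
    least? (x ∷ xs) with least? xs | P? x
    ... | inj₁ none | no ¬px = inj₁ λ { (here refl) → ¬px ; (there x∈xs) → none x∈xs }
    ... | inj₁ none | yes px =
      inj₂ (x , px , λ { (here refl) _ → ≤-refl ; (there y∈xs) py → contradiction py (none y∈xs) })
    ... | inj₂ (m , pm , m-least) | no ¬px =
      inj₂ (m , pm , λ { (here refl) px → contradiction px ¬px ; (there y∈xs) → m-least y∈xs })
    ... | inj₂ (m , pm , m-least) | yes px with total x m
    ...   | inj₁ x≤m =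
      inj₂ (x , px , λ { (here refl) _ → ≤-refl ; (there y∈xs) py → ≤-trans x≤m (m-least y∈xs py) })
    ...   | inj₂ m≤x = inj₂ (m , pm , λ { (here refl) _ → m≤x ; (there y∈xs) → m-least y∈xs })

module _ {A : Set} {_≤ₐ_ : Rel A 0ℓ} where
  open Labels _≤ₐ_

  LexLeq-antisym : Antisymmetric _≡_ _≤ₐ_ → Antisymmetric _≡_ LexLeq
  LexLeq-antisym antisym nil nil = refl
  LexLeq-antisym antisym (less x≤y x≢y) (less y≤x _) = contradiction (antisym x≤y y≤x) x≢y
  LexLeq-antisym antisym (less _ x≢x) (same _) = contradiction refl x≢x
  LexLeq-antisym antisym (same _) (less _ x≢x) = contradiction refl x≢x
  LexLeq-antisym antisym (same xs≤ys) (same ys≤xs) =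
    cong (_ ∷_) (LexLeq-antisym antisym xs≤ys ys≤xs)

module VectorAlgebra {F : Set} {_+_ _*_ : F → F → F} { -_ : F → F} {0# 1# : F}
  (isCommutativeRing : IsCommutativeRing _≡_ _+_ _*_ -_ 0# 1#) where
  open IsCommutativeRing isCommutativeRing
    using (+-assoc; zeroˡ; distribʳ; +-isCommutativeSemigroup)

  +-commutativeSemigroup : CommutativeSemigroup 0ℓ 0ℓ
  +-commutativeSemigroup = record { isCommutativeSemigroup = +-isCommutativeSemigroup }

  open import Algebra.Properties.CommutativeSemigroup +-commutativeSemigroup using (x∙yz≈y∙xz)

  map-zeroˡ : ∀ {m} (v : Vec F m) → map (0# *_) v ≡ replicate m 0#
  map-zeroˡ v = trans (map-cong zeroˡ v) (map-const v 0#)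

  zipWith-swap : ∀ {m} (u v w : Vec F m) →
    zipWith _+_ u (zipWith _+_ v w) ≡ zipWith _+_ v (zipWith _+_ u w)
  zipWith-swap [] [] [] = refl
  zipWith-swap (a ∷ u) (b ∷ v) (c ∷ w) = cong₂ _∷_ (x∙yz≈y∙xz a b c) (zipWith-swap u v w)

  zipWith-map-distribʳ : ∀ {m} a b (v w : Vec F m) →
    zipWith _+_ (map (a *_) v) (zipWith _+_ (map (b *_) v) w) ≡ zipWith _+_ (map ((a + b) *_) v) w
  zipWith-map-distribʳ a b [] [] = refl
  zipWith-map-distribʳ a b (x ∷ v) (c ∷ w) = cong₂ _∷_ componentwise (zipWith-map-distribʳ a b v w)
    where
    componentwise : (a * x) + ((b * x) + c) ≡ ((a + b) * x) + c
    componentwise = trans (sym (+-assoc (a * x) (b * x) c)) (cong (_+ c) (sym (distribʳ x a b)))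

module Geometry {q : ℕ} (𝔽 : FiniteField q) (n : ℕ) where
  open FiniteField 𝔽
  open IsCommutativeRing isCommutativeRing using (-‿inverseʳ; +-identityˡ)
  open VectorAlgebra isCommutativeRing
  open PDposet 𝔽 n hiding (Line)

  _≟F_ : DecidableEquality F
  _≟F_ = via-injection (↔⇒↣ enum) _≟Fin_

  elements : List F
  elements = List.map (Inverse.from enum) (allFin q)

  ∈-elements : ∀ x → x ∈ elements
  ∈-elements = map⁺ (setoid (Fin q)) (setoid F) (↔⇒↠ (↔-sym enum)) ∈-allFin

  Normalized-irrelevant : ∀ {m} {v : Vec F m} (p p′ : Normalized v) → p ≡ p′
  Normalized-irrelevant (lead v) (lead .v) = refl
  -- Matching lead against skip unifies the fields 1# and 0# of 𝔽.
  Normalized-irrelevant (lead v) (skip _) = contradiction refl 0≢1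
  Normalized-irrelevant (skip _) (lead _) = contradiction refl 0≢1
  Normalized-irrelevant (skip p) (skip p′) = cong skip (Normalized-irrelevant p p′)

  normalized? : ∀ {m} (v : Vec F m) → Dec (Normalized v)
  normalized? [] = no (λ ())
  normalized? (x ∷ v) with x ≟F 1# | x ≟F 0#
  ... | yes refl | _ = yes (lead v)
  ... | no x≢1 | no x≢0 = no λ { (lead _) → x≢1 refl ; (skip _) → x≢0 refl }
  ... | no x≢1 | yes refl with normalized? v
  ...   | yes p = yes (skip p)
  ...   | no ¬p = no λ { (lead _) → x≢1 refl ; (skip p) → ¬p p }

  _≟V_ : ∀ {m} → DecidableEquality (Vec F m)
  _≟V_ = Vec-≡-dec _≟F_

  _≟L_ : DecidableEquality (Line 𝔽 n)
  _≟L_ = Σ-≡-dec _≟V_ (λ p p′ → yes (Normalized-irrelevant p p′))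

  open import Data.List.Membership.DecPropositional _≟L_ using (_∈?_)

  lines : List (Line 𝔽 n)
  lines = filterΣ normalized? (vectors elements n)

  ∈-lines : ∀ l → l ∈ lines
  ∈-lines (v , p) = ∈-filterΣ normalized? Normalized-irrelevant p (∈-vectors ∈-elements v)

  zeros : ∀ {m} → Vec F m
  zeros = replicate _ 0#

  private variable
    l m : Line 𝔽 n
    ls xs ys zs S T A B L L′ M M′ Z : List (Line 𝔽 n)

  lincomb-0∷ : ∀ l ls (cs : Vec F (length ls)) → lincomb (l ∷ ls) (0# ∷ cs) ≡ lincomb ls cs
  lincomb-0∷ l ls cs =
    trans (cong (_+V lincomb ls cs) (map-zeroˡ (vec l))) (zipWith-identityˡ +-identityˡ _)

  lincomb-zeros : ∀ ls → lincomb ls zeros ≡ zeroV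
  lincomb-zeros [] = refl
  lincomb-zeros (l ∷ ls) = trans (lincomb-0∷ l ls zeros) (lincomb-zeros ls)

  Independent-∷⁻ : Independent (l ∷ ls) → Independent ls
  Independent-∷⁻ {l} {ls} ind cs lincomb≡0 =
    cong tail (ind (0# ∷ cs) (trans (lincomb-0∷ l ls cs) lincomb≡0))

  ¬Independent-dup : ¬ Independent (l ∷ l ∷ ls)
  ¬Independent-dup {l} {ls} ind = 0≢1 (sym (cong head (ind (1# ∷ (- 1#) ∷ zeros) 1·l-1·l≡0)))
    where
    open ≡-Reasoning
    1·l-1·l≡0 : lincomb (l ∷ l ∷ ls) (1# ∷ (- 1#) ∷ zeros) ≡ zeroV
    1·l-1·l≡0 = begin
      lincomb (l ∷ l ∷ ls) (1# ∷ (- 1#) ∷ zeros)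
        ≡⟨ zipWith-map-distribʳ 1# (- 1#) (vec l) _ ⟩
      lincomb (l ∷ ls) ((1# + (- 1#)) ∷ zeros)
        ≡⟨ cong (λ c → lincomb (l ∷ ls) (c ∷ zeros)) (-‿inverseʳ 1#) ⟩
      lincomb (l ∷ ls) (0# ∷ zeros)
        ≡⟨ lincomb-0∷ l ls zeros ⟩
      lincomb ls zeros
        ≡⟨ lincomb-zeros ls ⟩
      zeroV ∎

  record Reindexing (xs ys : List (Line 𝔽 n)) : Set where
    field
      reindex : Vec F (length ys) → Vec F (length xs)
      lincomb-reindex : ∀ cs → lincomb xs (reindex cs) ≡ lincomb ys cs
      reindex-reflects-zeros : ∀ cs → reindex cs ≡ zeros → cs ≡ zeros
  open Reindexing

  Reindexing-trans : Reindexing xs ys → Reindexing ys zs → Reindexing xs zs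
  Reindexing-trans R R′ .reindex cs = R .reindex (R′ .reindex cs)
  Reindexing-trans R R′ .lincomb-reindex cs =
    trans (R .lincomb-reindex (R′ .reindex cs)) (R′ .lincomb-reindex cs)
  Reindexing-trans R R′ .reindex-reflects-zeros cs eq =
    R′ .reindex-reflects-zeros cs (R .reindex-reflects-zeros (R′ .reindex cs) eq)

  ↭⇒Reindexing : xs ↭ ys → Reindexing xs ys
  ↭⇒Reindexing ↭.refl .reindex cs = cs
  ↭⇒Reindexing ↭.refl .lincomb-reindex cs = refl
  ↭⇒Reindexing ↭.refl .reindex-reflects-zeros cs eq = eq
  ↭⇒Reindexing (↭.prep l p) .reindex (c ∷ cs) = c ∷ ↭⇒Reindexing p .reindex cs
  ↭⇒Reindexing (↭.prep l p) .lincomb-reindex (c ∷ cs) =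
    cong ((c ·V vec l) +V_) (↭⇒Reindexing p .lincomb-reindex cs)
  ↭⇒Reindexing (↭.prep l p) .reindex-reflects-zeros (c ∷ cs) eq =
    cong₂ _∷_ (cong head eq) (↭⇒Reindexing p .reindex-reflects-zeros cs (cong tail eq))
  ↭⇒Reindexing (↭.swap l l′ p) .reindex (a ∷ b ∷ cs) = b ∷ a ∷ ↭⇒Reindexing p .reindex cs
  ↭⇒Reindexing (↭.swap l l′ p) .lincomb-reindex (a ∷ b ∷ cs) =
    trans (zipWith-swap _ _ _)
          (cong (((a ·V vec l′) +V_) ∘ ((b ·V vec l) +V_)) (↭⇒Reindexing p .lincomb-reindex cs))
  ↭⇒Reindexing (↭.swap l l′ p) .reindex-reflects-zeros (a ∷ b ∷ cs) eq =
    cong₂ _∷_ (cong (head ∘ tail) eq)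
      (cong₂ _∷_ (cong head eq) (↭⇒Reindexing p .reindex-reflects-zeros cs (cong (tail ∘ tail) eq)))
  ↭⇒Reindexing (↭.trans p p′) = Reindexing-trans (↭⇒Reindexing p) (↭⇒Reindexing p′)

  Independent-resp-↭ : xs ↭ ys → Independent xs → Independent ys
  Independent-resp-↭ p ind cs lincomb≡0 =
    reindex-reflects-zeros R cs (ind (reindex R cs) (trans (lincomb-reindex R cs) lincomb≡0))
    where R = ↭⇒Reindexing p

  Independent-++⁻ʳ : ∀ xs → Independent (xs ++ ys) → Independent ys
  Independent-++⁻ʳ [] ind = ind
  Independent-++⁻ʳ (_ ∷ xs) ind = Independent-++⁻ʳ xs (Independent-∷⁻ ind)

  Independent-++⁻ˡ : ∀ xs → Independent (xs ++ ys) → Independent xs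
  Independent-++⁻ˡ {ys} xs = Independent-++⁻ʳ ys ∘ Independent-resp-↭ (++-comm xs ys)

  Independent⇒∉ : Independent (l ∷ ls) → l ∉ ls
  Independent⇒∉ {l} ind l∈ls with as , bs , refl ← ∈-∃++ l∈ls =
    ¬Independent-dup (Independent-resp-↭ (↭.prep l (shift l as bs)) ind)

  Independent⇒Unique : Independent ls → Unique ls
  Independent⇒Unique {[]} _ = []
  Independent⇒Unique {l ∷ ls} ind =
    ¬Any⇒All¬ ls (Independent⇒∉ ind) ∷ Independent⇒Unique (Independent-∷⁻ ind)

  Independent-⊆ : Unique T → T ⊆ B → Independent B → Independent T
  Independent-⊆ {T} uT T⊆B iB with R , B↭T++R ← unique∧⊆⇒↭++ uT T⊆B =
    Independent-++⁻ˡ T (Independent-resp-↭ B↭T++R iB)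

  Independent-⊆-++ : Unique A → A ⊆ T → Independent (T ++ M) → Independent (A ++ M)
  Independent-⊆-++ {A} {T} {M} uA A⊆T iTM with R , T↭A++R ← unique∧⊆⇒↭++ uA A⊆T =
    Independent-++⁻ʳ R (Independent-resp-↭ T++M↭R++A++M iTM)
    where
    T++M↭R++A++M : T ++ M ↭ R ++ A ++ M
    T++M↭R++A++M = ↭-trans (↭-++⁺ʳ M T↭A++R) (↭-trans (++-assoc A R M) (shifts A R))

  Independent-∷⁺ : l ∉ S → Independent S → l ∈ Z → S ⊆ Z → Independent Z → Independent (l ∷ S)
  Independent-∷⁺ l∉S iS l∈Z S⊆Z =
    Independent-⊆ (¬Any⇒All¬ _ l∉S ∷ Independent⇒Unique iS) (∈-∷⁺ʳ l∈Z S⊆Z)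

  independent? : ∀ ls → Dec (Independent ls)
  independent? ls = ∀?-enumerated (∈-vectors ∈-elements)
    (λ cs → lincomb ls cs ≟V zeroV →-dec cs ≟V zeros)

  private variable
    y : PD

  <P-∷ : l ∉ S → {iS : Independent S} {iT : Independent (l ∷ S)} → set S iS <P set (l ∷ S) iT
  <P-∷ {l} {S} l∉S = set≤set (xs⊆x∷xs S l) , λ { (set≤set l∷S⊆S) → l∉S (l∷S⊆S (here refl)) }

  ⋖-∷ : l ∉ S → {iS : Independent S} {iT : Independent (l ∷ S)} → set S iS ⋖ set (l ∷ S) iT
  ⋖-∷ {l} {S} l∉S {iS} {iT} = <P-∷ l∉S , nothing-between
    where
    nothing-between : ¬ ∃ λ z → set S iS <P z × z <P set (l ∷ S) iT
    nothing-between (set Z _ , (set≤set S⊆Z , Z≰S) , (set≤set Z⊆l∷S , l∷S≰Z)) with l ∈? Z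
    ... | yes l∈Z = l∷S≰Z (set≤set (∈-∷⁺ʳ l∈Z S⊆Z))
    ... | no l∉Z = Z≰S (set≤set (⊆∷∧∉⇒⊆ Z⊆l∷S l∉Z))
    nothing-between (top , _ , (() , _))

  ⋖⇒⊆ : ∀ {iS iT} → set S iS ⋖ set T iT → S ⊆ T
  ⋖⇒⊆ ((set≤set S⊆T , _) , _) = S⊆T

  ⋖-added⇒⊆ : ∀ {iS iT} → set S iS ⋖ set T iT → l ∈ T → l ∉ S → T ⊆ l ∷ S
  ⋖-added⇒⊆ {S = S} {l = l} {iS = iS} {iT = iT} S⋖T@(_ , nothing-between) l∈T l∉S {t} t∈T =
    decidable-stable (t ∈? (l ∷ S)) λ t∉l∷S →
      nothing-between (set (l ∷ S) il∷S , <P-∷ l∉S ,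
        set≤set (∈-∷⁺ʳ l∈T (⋖⇒⊆ S⋖T)) , λ { (set≤set T⊆l∷S) → t∉l∷S (T⊆l∷S t∈T) })
    where
    il∷S : Independent (l ∷ S)
    il∷S = Independent-∷⁺ l∉S iS l∈T (⋖⇒⊆ S⋖T) iT

  Maximal : List (Line 𝔽 n) → Set
  Maximal L = ∀ l → ¬ Independent (l ∷ L)

  ⋖top⇒Maximal : ∀ {iS} → set S iS ⋖ top → Maximal S
  ⋖top⇒Maximal (_ , nothing-between) l il∷S =
    nothing-between (set (_ ∷ _) il∷S , <P-∷ (Independent⇒∉ il∷S) , (_ ≤top) , λ ())

  Maximal⇒⋖top : Maximal S → ∀ {iS} → set S iS ⋖ top
  Maximal⇒⋖top {S = S} maximal {iS} = ((_ ≤top) , λ ()) , nothing-between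
    where
    nothing-between : ¬ ∃ λ z → set S iS <P z × z <P top
    nothing-between (set Z iZ , (set≤set S⊆Z , Z≰S) , _) = Z≰S (set≤set Z⊆S)
      where
      Z⊆S : Z ⊆ S
      Z⊆S {l} l∈Z = decidable-stable (l ∈? S) λ l∉S →
        maximal l (Independent-∷⁺ l∉S iS l∈Z S⊆Z iZ)
    nothing-between (top , _ , (_ , top≰top)) = top≰top (top ≤top)

  Inside : PD → Line 𝔽 n → Set
  Inside (set T _) l = l ∈ T
  Inside top _ = ⊤

  Reaches : PD → List (Line 𝔽 n) → Set
  Reaches (set T _) L = L ⊆ T × T ⊆ L
  Reaches top L = Maximal L

  Reaches⇒Inside : ∀ y → Reaches y L → l ∈ L → Inside y l
  Reaches⇒Inside (set T _) (L⊆T , _) l∈L = L⊆T l∈L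
  Reaches⇒Inside top _ _ = tt

  Reaches-resp-≈ : ∀ y → Independent L → L ⊆ L′ → L′ ⊆ L → Reaches y L → Reaches y L′
  Reaches-resp-≈ (set T _) _ L⊆L′ L′⊆L (L⊆T , T⊆L) = ⊆-trans L′⊆L L⊆T , ⊆-trans T⊆L L⊆L′
  Reaches-resp-≈ top iL L⊆L′ _ maximal l il∷L′ =
    maximal l (Independent-∷⁺ (Independent⇒∉ il∷L′ ∘ L⊆L′) iL (here refl) (there ∘ L⊆L′) il∷L′)

  Spans : PD → List (Line 𝔽 n) → Set
  Spans y L = Independent L × Reaches y L

  Spans-resp-↭ : ∀ y → L ↭ L′ → Spans y L → Spans y L′
  Spans-resp-↭ y L↭L′ (iL , reaches) =
    Independent-resp-↭ L↭L′ iL ,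
    Reaches-resp-≈ y iL (⊆-reflexive-↭ L↭L′) (⊆-reflexive-↭ (↭-sym L↭L′)) reaches

  Completes : PD → List (Line 𝔽 n) → List (Line 𝔽 n) → Set
  Completes y S M = Spans y (S ++ M)

  Completes-resp-↭ : ∀ y → M ↭ M′ → Completes y S M → Completes y S M′
  Completes-resp-↭ {S = S} y M↭M′ = Spans-resp-↭ y (↭-++⁺ˡ S M↭M′)

  Completes-∷ : ∀ y → Completes y S (l ∷ M) → Completes y (l ∷ S) M
  Completes-∷ {S = S} {l = l} {M = M} y = Spans-resp-↭ y (shift l S M)

  Completes-≈ : ∀ y → Unique A → A ⊆ T → T ⊆ A → Completes y T M → Completes y A M
  Completes-≈ {M = M} y uA A⊆T T⊆A (iTM , reaches) =
    Independent-⊆-++ uA A⊆T iTM , Reaches-resp-≈ y iTM (⊆-++⁺ˡ M T⊆A) (⊆-++⁺ˡ M A⊆T) reaches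

  chain⇒Completes : ∀ {iS} → Chain (set S iS) y M → Completes y S M
  chain⇒Completes {S = S} {y = y@(set T _)} {iS = iS} (done (set≤set S⊆T) (set≤set T⊆S)) =
    Spans-resp-↭ y (↭-sym (++-identityʳ S)) (iS , S⊆T , T⊆S)
  chain⇒Completes {y = top} (done _ ())
  chain⇒Completes {S = S} {y = y} {M = l ∷ M} {iS = iS} (stepSet S⋖T l∈T l∉S rest) =
    Spans-resp-↭ y (↭-sym (shift l S M))
      (Completes-≈ y (¬Any⇒All¬ S l∉S ∷ Independent⇒Unique iS) (∈-∷⁺ʳ l∈T (⋖⇒⊆ S⋖T))
        (⋖-added⇒⊆ S⋖T l∈T l∉S) (chain⇒Completes rest))
  chain⇒Completes {S = S} {iS = iS} (stepTop S⋖top) =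
    Spans-resp-↭ top (↭-sym (++-identityʳ S)) (iS , ⋖top⇒Maximal S⋖top)

  Admissible : PD → List (Line 𝔽 n) → Line 𝔽 n → Set
  Admissible y S l = Independent (l ∷ S) × Inside y l

  admissible? : ∀ y S l → Dec (Admissible y S l)
  admissible? (set T _) S l = independent? (l ∷ S) ×-dec (l ∈? T)
  admissible? top S l = independent? (l ∷ S) ×-dec yes tt

  Admissible-∷⁻ : Admissible y (m ∷ S) l → Admissible y S l
  Admissible-∷⁻ {m = m} {l = l} (il∷m∷S , l-inside) =
    Independent-∷⁻ (Independent-resp-↭ (↭.swap l m ↭-refl) il∷m∷S) , l-inside

  Completes⇒Admissible : ∀ y → Completes y S (l ∷ M) → Admissible y S l
  Completes⇒Admissible {S = S} {l = l} y completes@(_ , reaches) =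
    Independent-++⁻ˡ (l ∷ S) (proj₁ (Completes-∷ y completes)) ,
    Reaches⇒Inside y reaches (∈-++⁺ʳ S (here refl))

  Admissible⇒¬Spans : ∀ y → Admissible y S l → ¬ Spans y S
  Admissible⇒¬Spans (set T _) (il∷S , l∈T) (_ , _ , T⊆S) = Independent⇒∉ il∷S (T⊆S l∈T)
  Admissible⇒¬Spans top (il∷S , _) (_ , maximal) = maximal _ il∷S

  ¬Admissible⇒Chain : ∀ {iS} → set S iS ≤P y → (∀ l → ¬ Admissible y S l) → Chain (set S iS) y []
  ¬Admissible⇒Chain {S = S} {iS = iS} (set≤set {T = T} {iT = iT} S⊆T) none =
    done (set≤set S⊆T) (set≤set T⊆S)
    where
    T⊆S : T ⊆ S
    T⊆S {l} l∈T = decidable-stable (l ∈? S) λ l∉S →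
      none l (Independent-∷⁺ l∉S iS l∈T S⊆T iT , l∈T)
  ¬Admissible⇒Chain (_ ≤top) none = stepTop (Maximal⇒⋖top (λ l il∷S → none l (il∷S , tt)))

  ≤P-∷ : ∀ {iS il∷S} → Inside y l → set S iS ≤P y → set (l ∷ S) il∷S ≤P y
  ≤P-∷ l∈T (set≤set S⊆T) = set≤set (∈-∷⁺ʳ l∈T S⊆T)
  ≤P-∷ _ (_ ≤top) = _ ≤top

  #linesOutside : List (Line 𝔽 n) → ℕ
  #linesOutside S = length (filter (λ l → ¬? (l ∈? S)) lines)

  #linesOutside-∷-< : l ∉ S → #linesOutside (l ∷ S) < #linesOutside S
  #linesOutside-∷-< {l} {S} l∉S =
    length-filter-< (λ x → ¬? (x ∈? (l ∷ S))) (λ x → ¬? (x ∈? S)) (λ ∉l∷S → ∉l∷S ∘ there)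
      (∈-lines l) l∉S (λ ∉l∷S → ∉l∷S (here refl))

module LeastChains {q : ℕ} (𝔽 : FiniteField q) (n : ℕ)
    (_≤ω_ : Rel (Line 𝔽 n) 0ℓ) (isTotalOrder : IsTotalOrder _≡_ _≤ω_) where
  open Geometry 𝔽 n
  open PDposet 𝔽 n hiding (Line)
  open Labels _≤ω_
  open IsTotalOrder isTotalOrder using (isTotalPreorder)

  record LeastChain (y : PD) (S : List (Line 𝔽 n)) (iS : Independent S) : Set where
    field
      labels : List (Line 𝔽 n)
      chain : Chain (set S iS) y labels
      least : ∀ M → Completes y S M → LexLeq labels M
      admissible : All (Admissible y S) labels
      sorted : AllPairs _≤ω_ labels

  leastChain : ∀ y S iS → set S iS ≤P y → Acc _<_ (#linesOutside S) → LeastChain y S iS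
  leastChain y S iS S≤y (acc smaller) with least? isTotalPreorder (admissible? y S) lines
  ... | inj₁ none = record
    { labels = []
    ; chain = ¬Admissible⇒Chain S≤y (λ l → none (∈-lines l))
    ; least = λ _ _ → nil
    ; admissible = []
    ; sorted = []
    }
  ... | inj₂ (g , g-admissible@(ig∷S , g-inside) , g-least) = record
    { labels = g ∷ R.labels
    ; chain = stepSet (⋖-∷ g∉S) (here refl) g∉S R.chain
    ; least = least-∷
    ; admissible = g-admissible ∷ All.map Admissible-∷⁻ R.admissible
    ; sorted = All.map (g-least (∈-lines _) ∘ Admissible-∷⁻) R.admissible ∷ R.sorted
    }
    where
    g∉S : g ∉ S
    g∉S = Independent⇒∉ ig∷S

    module R = LeastChain
      (leastChain y (g ∷ S) ig∷S (≤P-∷ g-inside S≤y) (smaller (#linesOutside-∷-< g∉S)))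

    least-∷ : ∀ M → Completes y S M → LexLeq (g ∷ R.labels) M
    least-∷ [] completes =
      contradiction (Spans-resp-↭ y (++-identityʳ S) completes) (Admissible⇒¬Spans y g-admissible)
    least-∷ (l ∷ M) completes with g ≟L l
    ... | yes refl = same (R.least M (Completes-∷ y completes))
    ... | no g≢l = less (g-least (∈-lines l) (Completes⇒Admissible y completes)) g≢l

open PDposet using (set; top; _≤top; done; stepTop)
open Labels using (nil)

proposition7p2 : ∀ {q : ℕ} (𝔽 : FiniteField q) (n : ℕ)
    (_≤ω_ : Rel (Line 𝔽 n) 0ℓ) → IsTotalOrder _≡_ _≤ω_ →
    LeastContentIncreasing 𝔽 n _≤ω_
proposition7p2 𝔽 n _≤ω_ isTotalOrder top top _ =
    ([] , done (top ≤top) (top ≤top) , λ _ _ → nil)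
  , λ { _ (done _ _) _ → [] , λ _ _ _ _ _ → nil
      ; _ (stepTop _) _ → [] , λ _ _ _ _ _ → nil
      }
proposition7p2 𝔽 n _≤ω_ isTotalOrder top (set _ _) ()
proposition7p2 𝔽 n _≤ω_ isTotalOrder (set S iS) y S≤y =
    (labels , chain , least-among-chains)
  , λ ls ls-chain ls-least →
      let ls≡labels = LexLeq-antisym antisym (ls-least labels chain)
                                             (least-among-chains ls ls-chain)
      in  subst Increasing (sym ls≡labels) (AllPairs⇒Linked sorted)
        , λ ls′ ls′-chain s s↭ls′ _ →
            subst (λ ls → LexLeq ls s) (sym ls≡labels)
              (least s (Completes-resp-↭ y (↭-sym s↭ls′) (chain⇒Completes ls′-chain)))
  where
  open PDposet 𝔽 n using (Chain)
  open Labels _≤ω_ using (LexLeq; Increasing)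
  open IsTotalOrder isTotalOrder using (antisym)
  open Geometry 𝔽 n
  open LeastChains 𝔽 n _≤ω_ isTotalOrder
  open LeastChain (leastChain y S iS S≤y (<-wellFounded _))

  least-among-chains : ∀ ls → Chain (set S iS) y ls → LexLeq labels ls
  least-among-chains ls = least ls ∘ chain⇒Completes
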